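{- Let $n\geq 1$ and consider the $(2n+3)\times 3n$ matrix $A$ whose columns are indexed by variables $x_1,\dots,x_n,y_1,\dots,y_n,z_1,\dots,z_n$ and whose rows are: row $a_1$ with entry $1$ in every $x_i$ and $z_i$ column and $0$ elsewhere; row $a_2$ with entry $1$ in every $y_i$ and $z_i$ column and $0$ elsewhere; row $a_3$ with entry $1$ in every $z_i$ column and $0$ elsewhere; for each $i\in[n]$, row $b_i$ with entries $1$ in columns $x_i$ and $z_i$ and $0$ elsewhere; and for each $i\in[n]$, row $c_i$ with entries $1$ in columns $y_i$ and $z_i$ and $0$ elsewhere. Then $A$ is totally unimodular. (Equivalently, the constraint matrix of the integer program $\min \sum_i C_i x_i+\sum_i \overline{c}_i y_i+\sum_i (C_i+\overline{c}_i)z_i$ subject to $\sum_i x_i+\sum_i z_i=p$, $\sum_i y_i+\sum_i z_i=p$, $\sum_i z_i\geq p-k$, $x_i+z_i\leq 1$, $y_i+z_i\leq 1$, $x_i,y_i,z_i\in\{0,1\}$ for $i\in[n]$, is totally unimodular.) -}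

module Defs where

open import Data.Nat using (ℕ; zero; suc)
open import Data.Fin using (Fin; zero; suc; punchIn; _≟_)
open import Data.Integer using (ℤ; +_; -_; _+_; _*_; 0ℤ; 1ℤ; -1ℤ)
open import Data.Sum using (_⊎_)
open import Relation.Binary.PropositionalEquality using (_≡_)
open import Relation.Nullary using (yes; no)
open import Function.Definitions using (Injective)

sgn : ℕ → ℤ
sgn zero = 1ℤ
sgn (suc j) = - sgn j

sumFin : ∀ {k} → (Fin k → ℤ) → ℤ
sumFin {zero} f = 0ℤ
sumFin {suc k} f = f zero + sumFin (λ i → f (suc i))

det : ∀ {k} → (Fin k → Fin k → ℤ) → ℤ
det {zero} M = 1ℤ
det {suc k} M =
  sumFin (λ j → sgn (Data.Fin.toℕ j) * (M zero j * det (λ r c → M (suc r) (punchIn j c))))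

-- A matrix with rows indexed by R and columns by C is totally unimodular if
-- every square submatrix (choice of k distinct rows and k distinct columns)
-- has determinant in {-1, 0, 1}.  (Reordering rows/columns only changes the
-- sign of the determinant, so injective choices are as good as increasing ones.)
TotallyUnimodular : {R C : Set} → (R → C → ℤ) → Set
TotallyUnimodular {R} {C} A =
  ∀ (k : ℕ) (r : Fin k → R) (c : Fin k → C) →
  Injective _≡_ _≡_ r → Injective _≡_ _≡_ c →
  (det (λ i j → A (r i) (c j)) ≡ 0ℤ) ⊎ (det (λ i j → A (r i) (c j)) ≡ 1ℤ) ⊎ (det (λ i j → A (r i) (c j)) ≡ -1ℤ)

data Row (n : ℕ) : Set where
  a₁ a₂ a₃ : Row n
  b c : Fin n → Row n

data Col (n : ℕ) : Set where
  x y z : Fin n → Col n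

δ : ∀ {n} → Fin n → Fin n → ℤ
δ i j with i ≟ j
... | yes _ = 1ℤ
... | no _ = 0ℤ

A : (n : ℕ) → Row n → Col n → ℤ
A n a₁ (x _) = 1ℤ
A n a₁ (y _) = 0ℤ
A n a₁ (z _) = 1ℤ
A n a₂ (x _) = 0ℤ
A n a₂ (y _) = 1ℤ
A n a₂ (z _) = 1ℤ
A n a₃ (x _) = 0ℤ
A n a₃ (y _) = 0ℤ
A n a₃ (z _) = 1ℤ
A n (b i) (x j) = δ i j
A n (b i) (y j) = 0ℤ
A n (b i) (z j) = δ i j
A n (c i) (x j) = 0ℤ
A n (c i) (y j) = δ i j
A n (c i) (z j) = δ i j

module Submission where

-- The matrix A is, up to the signs of its rows, the incidence-type matrix of a
-- "difference" system: each column is a pair (s , t) of points and each row a set e,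
-- with entry [t ∈ e] - [s ∈ e], where the sets are ranked so that no set is split by a
-- set of equal or larger rank (a laminar family).  Such matrices are totally
-- unimodular: in a square submatrix take a row e of minimal rank; if it is zero we are
-- done, otherwise pick a column p separated by e and add ±p to every other column so as
-- to clear row e.  Because e is minimal, every new column is again a difference column
-- (the two endpoints lying in e telescope away), so expanding along row e leaves ±1 times
-- a smaller difference matrix.

open import Defs
open import Data.Bool using (Bool; true; false)
import Data.Bool.Properties as Boolₚ
open import Data.Empty using (⊥-elim)
open import Data.Fin using (Fin; zero; suc; punchIn; punchOut; toℕ; inject₁; fromℕ<) renaming (_≟_ to _≟ᶠ_)
open import Data.Fin.Properties using (punchIn-punchOut; punchInᵢ≢i; punchIn-injective; toℕ-inject₁; toℕ<n; toℕ-fromℕ<; toℕ-injective; all?; ¬∀⟶∃¬)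
open import Data.Integer using (ℤ; +0; +[1+_]; -[1+_]; -_; _+_; _-_; _*_; 0ℤ; 1ℤ; -1ℤ)
import Data.Integer.Properties as ℤₚ
open import Data.Integer.Tactic.RingSolver using (solve-∀)
open import Data.Nat using (ℕ; zero; suc; z≤n; s≤s; _≤_)
import Data.Nat.Properties as ℕₚ
open import Data.Product using (Σ; ∃; _×_; _,_; proj₁; proj₂)
open import Data.Sum using (_⊎_; inj₁; inj₂)
open import Data.Vec.Functional using (updateAt)
open import Data.Vec.Functional.Properties using (updateAt-updates; updateAt-minimal)
open import Function using (_∘_; const)
open import Relation.Binary.PropositionalEquality
open import Relation.Nullary using (Dec; yes; no)
open import Relation.Nullary.Decidable using (⌊_⌋)

sum-cong : ∀ {k} {f g : Fin k → ℤ} → (∀ i → f i ≡ g i) → sumFin f ≡ sumFin g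
sum-cong {zero}  eq = refl
sum-cong {suc k} eq = cong₂ _+_ (eq zero) (sum-cong (eq ∘ suc))

sum-zero : ∀ {k} {f : Fin k → ℤ} → (∀ i → f i ≡ 0ℤ) → sumFin f ≡ 0ℤ
sum-zero {zero}  eq = refl
sum-zero {suc k} eq = cong₂ _+_ (eq zero) (sum-zero (eq ∘ suc))

sum-+ : ∀ {k} (f g : Fin k → ℤ) → sumFin (λ i → f i + g i) ≡ sumFin f + sumFin g
sum-+ {zero}  f g = refl
sum-+ {suc k} f g = trans (cong (f zero + g zero +_) (sum-+ (f ∘ suc) (g ∘ suc)))
                          (interchange (f zero) (g zero) (sumFin (f ∘ suc)) (sumFin (g ∘ suc)))
  where
  interchange : ∀ a b c d → (a + b) + (c + d) ≡ (a + c) + (b + d)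
  interchange = solve-∀

sum-scale : ∀ {k} α (f : Fin k → ℤ) → sumFin (λ i → α * f i) ≡ α * sumFin f
sum-scale {zero}  α f = sym (ℤₚ.*-zeroʳ α)
sum-scale {suc k} α f = trans (cong (α * f zero +_) (sum-scale α (f ∘ suc)))
                              (sym (ℤₚ.*-distribˡ-+ α _ _))

sum-neg : ∀ {k} (f : Fin k → ℤ) → sumFin (λ i → - f i) ≡ - sumFin f
sum-neg {zero}  f = refl
sum-neg {suc k} f = trans (cong (- f zero +_) (sum-neg (f ∘ suc))) (sym (ℤₚ.neg-distrib-+ (f zero) (sumFin (f ∘ suc))))

sum-comm : ∀ {k m} (g : Fin k → Fin m → ℤ) →
  sumFin (λ i → sumFin (g i)) ≡ sumFin (λ j → sumFin (λ i → g i j))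
sum-comm {zero} {m} g = sym (sum-zero {m} (λ _ → refl))
sum-comm {suc k} g = trans (cong (sumFin (g zero) +_) (sum-comm (g ∘ suc)))
                           (sym (sum-+ (g zero) (λ j → sumFin (λ i → g (suc i) j))))

IsSign : ℤ → Set
IsSign s = s ≡ 1ℤ ⊎ s ≡ -1ℤ

Is0±1 : ℤ → Set
Is0±1 d = d ≡ 0ℤ ⊎ d ≡ 1ℤ ⊎ d ≡ -1ℤ

sgn-isSign : ∀ n → IsSign (sgn n)
sgn-isSign zero = inj₁ refl
sgn-isSign (suc n) with sgn n | sgn-isSign n
... | _ | inj₁ refl = inj₂ refl
... | _ | inj₂ refl = inj₁ refl

sign-* : ∀ {s t} → IsSign s → IsSign t → IsSign (s * t)
sign-* (inj₁ refl) (inj₁ refl) = inj₁ refl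
sign-* (inj₁ refl) (inj₂ refl) = inj₂ refl
sign-* (inj₂ refl) (inj₁ refl) = inj₂ refl
sign-* (inj₂ refl) (inj₂ refl) = inj₁ refl

sign-*-0±1 : ∀ {s d} → IsSign s → Is0±1 d → Is0±1 (s * d)
sign-*-0±1 (inj₁ refl) (inj₁ refl)        = inj₁ refl
sign-*-0±1 (inj₁ refl) (inj₂ (inj₁ refl)) = inj₂ (inj₁ refl)
sign-*-0±1 (inj₁ refl) (inj₂ (inj₂ refl)) = inj₂ (inj₂ refl)
sign-*-0±1 (inj₂ refl) (inj₁ refl)        = inj₁ refl
sign-*-0±1 (inj₂ refl) (inj₂ (inj₁ refl)) = inj₂ (inj₂ refl)
sign-*-0±1 (inj₂ refl) (inj₂ (inj₂ refl)) = inj₂ (inj₁ refl)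

sign-cancel : ∀ {s} → IsSign s → ∀ d → s * (s * d) ≡ d
sign-cancel (inj₁ refl) = solve-∀
sign-cancel (inj₂ refl) = solve-∀

self-neg : ∀ d → d ≡ - d → d ≡ 0ℤ
self-neg +0        _ = refl
self-neg +[1+ n ]  ()
self-neg -[1+ n ]  ()

Mat : ℕ → Set
Mat k = Fin k → Fin k → ℤ

sgnᶠ : ∀ {k} → Fin k → ℤ
sgnᶠ i = sgn (toℕ i)

minor : ∀ {k} → Mat (suc k) → Fin (suc k) → Mat k
minor M j r q = M (suc r) (punchIn j q)

expansionTerm : ∀ {k} → Mat (suc k) → Fin (suc k) → ℤ
expansionTerm M j = sgnᶠ j * (M zero j * det (minor M j))

_ᵀ : ∀ {k} → Mat k → Mat k
(M ᵀ) i j = M j i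

det-cong : ∀ {k} {M N : Mat k} → (∀ i j → M i j ≡ N i j) → det M ≡ det N
det-cong {zero}  eq = refl
det-cong {suc k} eq = sum-cong λ j →
  cong₂ (λ a d → sgnᶠ j * (a * d)) (eq zero j) (det-cong (λ r q → eq (suc r) (punchIn j q)))

zero-entry : ∀ s d → s * (0ℤ * d) ≡ 0ℤ
zero-entry = solve-∀

zero-minor : ∀ s a → s * (a * 0ℤ) ≡ 0ℤ
zero-minor = solve-∀

det-zero-row : ∀ {k} (M : Mat k) (i : Fin k) → (∀ j → M i j ≡ 0ℤ) → det M ≡ 0ℤ
det-zero-row {suc k} M zero    zeroRow = sum-zero λ j →
  trans (cong (λ a → sgnᶠ j * (a * det (minor M j))) (zeroRow j)) (zero-entry (sgnᶠ j) (det (minor M j)))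
det-zero-row {suc k} M (suc i) zeroRow = sum-zero λ j →
  trans (cong (λ d → sgnᶠ j * (M zero j * d)) (det-zero-row (minor M j) i (zeroRow ∘ punchIn j)))
        (zero-minor (sgnᶠ j) (M zero j))

-- Expansion along the first column: the column minors of M are the transposed
-- row minors of Mᵀ.  Proved by expanding each row minor along its first column
-- and exchanging the resulting double sum.
det-first-col : ∀ {k} (M : Mat (suc k)) →
  det M ≡ sumFin (λ i → sgnᶠ i * (M i zero * det (minor (M ᵀ) i ᵀ)))
det-first-col {zero}  M = refl
det-first-col {suc k} M = cong (sgnᶠ {suc (suc k)} zero * (M zero zero * det (minor M zero)) +_) tails
  where
  open ≡-Reasoning
  D : Fin (suc k) → Fin (suc k) → ℤ
  D i j = det (λ r q → M (suc (punchIn i r)) (suc (punchIn j q)))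
  pull : ∀ (s a : ℤ) (f : Fin (suc k) → ℤ) → s * (a * sumFin f) ≡ sumFin (λ i → s * (a * f i))
  pull s a f = trans (cong (s *_) (sym (sum-scale a f))) (sym (sum-scale s (λ i → a * f i)))
  reorder : ∀ sj si a b d → - sj * (a * (si * (b * d))) ≡ - si * (b * (sj * (a * d)))
  reorder = solve-∀
  tails : sumFin (λ j → - sgnᶠ j * (M zero (suc j) * det (minor M (suc j))))
        ≡ sumFin (λ i → - sgnᶠ i * (M (suc i) zero * det (minor (M ᵀ) (suc i) ᵀ)))
  tails = begin
      sumFin (λ j → - sgnᶠ j * (M zero (suc j) * det (minor M (suc j))))
    ≡⟨ sum-cong (λ j → cong (λ d → - sgnᶠ j * (M zero (suc j) * d)) (det-first-col (minor M (suc j)))) ⟩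
      sumFin (λ j → - sgnᶠ j * (M zero (suc j) * sumFin (λ i → sgnᶠ i * (M (suc i) zero * D i j))))
    ≡⟨ sum-cong (λ j → pull (- sgnᶠ j) (M zero (suc j)) (λ i → sgnᶠ i * (M (suc i) zero * D i j))) ⟩
      sumFin (λ j → sumFin (λ i → - sgnᶠ j * (M zero (suc j) * (sgnᶠ i * (M (suc i) zero * D i j)))))
    ≡⟨ sum-cong (λ j → sum-cong (λ i → reorder (sgnᶠ j) (sgnᶠ i) (M zero (suc j)) (M (suc i) zero) (D i j))) ⟩
      sumFin (λ j → sumFin (λ i → - sgnᶠ i * (M (suc i) zero * (sgnᶠ j * (M zero (suc j) * D i j)))))
    ≡⟨ sum-comm (λ j i → - sgnᶠ i * (M (suc i) zero * (sgnᶠ j * (M zero (suc j) * D i j)))) ⟩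
      sumFin (λ i → sumFin (λ j → - sgnᶠ i * (M (suc i) zero * (sgnᶠ j * (M zero (suc j) * D i j)))))
    ≡⟨ sum-cong (λ i → sym (pull (- sgnᶠ i) (M (suc i) zero) (λ j → sgnᶠ j * (M zero (suc j) * D i j)))) ⟩
      sumFin (λ i → - sgnᶠ i * (M (suc i) zero * det (minor (M ᵀ) (suc i) ᵀ)))
    ∎

-- det Mᵀ = det M, by comparing the first-row expansion of Mᵀ with the first-column one of M.
det-transpose : ∀ {k} (M : Mat k) → det (M ᵀ) ≡ det M
det-transpose {zero}  M = refl
det-transpose {suc k} M = trans
  (sum-cong λ i → cong (λ d → sgnᶠ i * (M i zero * d)) (det-transpose (minor (M ᵀ) i ᵀ)))
  (sym (det-first-col M))

det-linear-col : ∀ {k} (M N P : Mat k) (j : Fin k) (α β : ℤ) →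
  (∀ i → M i j ≡ α * N i j + β * P i j) →
  (∀ i q → q ≢ j → M i q ≡ N i q) → (∀ i q → q ≢ j → M i q ≡ P i q) →
  det M ≡ α * det N + β * det P
det-linear-col {suc k} M N P j α β onCol offN offP = begin
    det M
  ≡⟨ sum-cong term ⟩
    sumFin (λ m → α * tN m + β * tP m)
  ≡⟨ sum-+ (λ m → α * tN m) (λ m → β * tP m) ⟩
    sumFin (λ m → α * tN m) + sumFin (λ m → β * tP m)
  ≡⟨ cong₂ _+_ (sum-scale α tN) (sum-scale β tP) ⟩
    α * det N + β * det P
  ∎
  where
  open ≡-Reasoning
  tN tP : Fin (suc k) → ℤ
  tN = expansionTerm N
  tP = expansionTerm P
  atCol : ∀ α β s a b d → s * ((α * a + β * b) * d) ≡ α * (s * (a * d)) + β * (s * (b * d))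
  atCol = solve-∀
  offCol : ∀ α β s a d e → s * (a * (α * d + β * e)) ≡ α * (s * (a * d)) + β * (s * (a * e))
  offCol = solve-∀
  term : ∀ m → expansionTerm M m ≡ α * tN m + β * tP m
  term m with m ≟ᶠ j
  ... | yes refl = begin
      sgnᶠ m * (M zero m * det (minor M m))
    ≡⟨ cong₂ (λ a d → sgnᶠ m * (a * d)) (onCol zero) (det-cong λ r q → offN (suc r) (punchIn m q) (punchInᵢ≢i m q)) ⟩
      sgnᶠ m * ((α * N zero m + β * P zero m) * det (minor N m))
    ≡⟨ atCol α β (sgnᶠ m) (N zero m) (P zero m) (det (minor N m)) ⟩
      α * tN m + β * (sgnᶠ m * (P zero m * det (minor N m)))
    ≡⟨ cong (λ d → α * tN m + β * (sgnᶠ m * (P zero m * d)))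
            (det-cong λ r q → trans (sym (offN (suc r) (punchIn m q) (punchInᵢ≢i m q))) (offP (suc r) (punchIn m q) (punchInᵢ≢i m q))) ⟩
      α * tN m + β * tP m
    ∎
  ... | no m≢j = begin
      sgnᶠ m * (M zero m * det (minor M m))
    ≡⟨ cong₂ (λ a d → sgnᶠ m * (a * d)) (offN zero m m≢j) minorLinear ⟩
      sgnᶠ m * (N zero m * (α * det (minor N m) + β * det (minor P m)))
    ≡⟨ offCol α β (sgnᶠ m) (N zero m) (det (minor N m)) (det (minor P m)) ⟩
      α * tN m + β * (sgnᶠ m * (N zero m * det (minor P m)))
    ≡⟨ cong (λ a → α * tN m + β * (sgnᶠ m * (a * det (minor P m)))) (trans (sym (offN zero m m≢j)) (offP zero m m≢j)) ⟩
      α * tN m + β * tP m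
    ∎
    where
    j′ = punchOut m≢j
    back : ∀ {q} → q ≢ j′ → punchIn m q ≢ j
    back q≢j′ eq = q≢j′ (punchIn-injective m _ _ (trans eq (sym (punchIn-punchOut m≢j))))
    minorLinear : det (minor M m) ≡ α * det (minor N m) + β * det (minor P m)
    minorLinear = det-linear-col (minor M m) (minor N m) (minor P m) j′ α β
      (λ r → subst (λ c → M (suc r) c ≡ α * N (suc r) c + β * P (suc r) c) (sym (punchIn-punchOut m≢j)) (onCol (suc r)))
      (λ r q q≢ → offN (suc r) (punchIn m q) (back q≢))
      (λ r q q≢ → offP (suc r) (punchIn m q) (back q≢))

swapAdj : ∀ {k} → Fin (suc k) → Fin (suc (suc k)) → Fin (suc (suc k))
swapAdj zero    zero          = suc zero
swapAdj zero    (suc zero)    = zero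
swapAdj zero    (suc (suc q)) = suc (suc q)
swapAdj (suc j) zero          = zero
swapAdj {suc k} (suc j) (suc q) = suc (swapAdj j q)

swap-left : ∀ {k} (j : Fin (suc k)) → swapAdj j (inject₁ j) ≡ suc j
swap-left zero = refl
swap-left {suc k} (suc j) = cong suc (swap-left j)

swap-right : ∀ {k} (j : Fin (suc k)) → swapAdj j (suc j) ≡ inject₁ j
swap-right zero = refl
swap-right {suc k} (suc j) = cong suc (swap-right j)

swap-other : ∀ {k} (j : Fin (suc k)) q → q ≢ inject₁ j → q ≢ suc j → swapAdj j q ≡ q
swap-other zero zero          q≢l q≢r = ⊥-elim (q≢l refl)
swap-other zero (suc zero)    q≢l q≢r = ⊥-elim (q≢r refl)
swap-other zero (suc (suc q)) q≢l q≢r = refl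
swap-other (suc j) zero       q≢l q≢r = refl
swap-other {suc k} (suc j) (suc q) q≢l q≢r = cong suc (swap-other j q (q≢l ∘ cong suc) (q≢r ∘ cong suc))

swap-punchIn-left : ∀ {k} (j q : Fin (suc k)) → swapAdj j (punchIn (inject₁ j) q) ≡ punchIn (suc j) q
swap-punchIn-left zero    zero    = refl
swap-punchIn-left zero    (suc q) = refl
swap-punchIn-left (suc j) zero    = refl
swap-punchIn-left {suc k} (suc j) (suc q) = cong suc (swap-punchIn-left j q)

swap-punchIn-right : ∀ {k} (j q : Fin (suc k)) → swapAdj j (punchIn (suc j) q) ≡ punchIn (inject₁ j) q
swap-punchIn-right zero    zero    = refl
swap-punchIn-right zero    (suc q) = refl
swap-punchIn-right (suc j) zero    = refl
swap-punchIn-right {suc k} (suc j) (suc q) = cong suc (swap-punchIn-right j q)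

swap-punchIn-other : ∀ {k} (m : Fin (suc (suc (suc k)))) (j : Fin (suc (suc k))) → m ≢ inject₁ j → m ≢ suc j →
  Σ (Fin (suc k)) λ j′ → ∀ q → swapAdj j (punchIn m q) ≡ punchIn m (swapAdj j′ q)
swap-punchIn-other zero zero m≢l m≢r = ⊥-elim (m≢l refl)
swap-punchIn-other zero (suc j) m≢l m≢r = j , λ q → refl
swap-punchIn-other (suc zero) zero m≢l m≢r = ⊥-elim (m≢r refl)
swap-punchIn-other (suc (suc m)) zero m≢l m≢r = zero , λ
  { zero → refl ; (suc zero) → refl ; (suc (suc q)) → refl }
swap-punchIn-other {zero} (suc zero) (suc zero) m≢l m≢r = ⊥-elim (m≢l refl)
swap-punchIn-other {zero} (suc (suc zero)) (suc zero) m≢l m≢r = ⊥-elim (m≢r refl)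
swap-punchIn-other {suc k} (suc m) (suc j) m≢l m≢r
  with swap-punchIn-other m j (m≢l ∘ cong suc) (m≢r ∘ cong suc)
... | j′ , commute = suc j′ , λ { zero → refl ; (suc q) → cong suc (commute q) }

sum-swap : ∀ {k} (j : Fin (suc k)) (f : Fin (suc (suc k)) → ℤ) → sumFin (f ∘ swapAdj j) ≡ sumFin f
sum-swap {k} zero f = exchange (f (suc zero)) (f zero) (sumFin {k} (λ i → f (suc (suc i))))
  where
  exchange : ∀ a b c → a + (b + c) ≡ b + (a + c)
  exchange = solve-∀
sum-swap {suc k} (suc j) f = cong (f zero +_) (sum-swap j (f ∘ suc))

swapCols : ∀ {k} → Mat (suc (suc k)) → Fin (suc k) → Mat (suc (suc k))
swapCols M j i q = M i (swapAdj j q)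

-- In the expansion of swapCols M j, the terms at the two exchanged positions are minus
-- the terms of M at the other position: same entry and minor, opposite sign (-1)ʲ, (-1)ʲ⁺¹.
swap-term-left : ∀ {k} (M : Mat (suc (suc k))) (j : Fin (suc k)) →
  expansionTerm (swapCols M j) (inject₁ j) ≡ - expansionTerm M (suc j)
swap-term-left M j = begin
    sgnᶠ (inject₁ j) * (M zero (swapAdj j (inject₁ j)) * det (minor (swapCols M j) (inject₁ j)))
  ≡⟨ cong₂ (λ s c → s * (M zero c * det (minor (swapCols M j) (inject₁ j)))) (cong sgn (toℕ-inject₁ j)) (swap-left j) ⟩
    sgnᶠ j * (M zero (suc j) * det (minor (swapCols M j) (inject₁ j)))
  ≡⟨ cong (λ d → sgnᶠ j * (M zero (suc j) * d)) (det-cong λ r q → cong (M (suc r)) (swap-punchIn-left j q)) ⟩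
    sgnᶠ j * (M zero (suc j) * det (minor M (suc j)))
  ≡⟨ flipSign (sgnᶠ j) (M zero (suc j) * det (minor M (suc j))) ⟩
    - expansionTerm M (suc j)
  ∎
  where
  open ≡-Reasoning
  flipSign : ∀ s x → s * x ≡ - (- s * x)
  flipSign = solve-∀

swap-term-right : ∀ {k} (M : Mat (suc (suc k))) (j : Fin (suc k)) →
  expansionTerm (swapCols M j) (suc j) ≡ - expansionTerm M (inject₁ j)
swap-term-right M j = begin
    - sgnᶠ j * (M zero (swapAdj j (suc j)) * det (minor (swapCols M j) (suc j)))
  ≡⟨ cong₂ (λ c d → - sgnᶠ j * (M zero c * d)) (swap-right j) (det-cong λ r q → cong (M (suc r)) (swap-punchIn-right j q)) ⟩
    - sgnᶠ j * (M zero (inject₁ j) * det (minor M (inject₁ j)))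
  ≡⟨ ℤₚ.neg-distribˡ-* (sgnᶠ j) _ ⟨
    - (sgnᶠ j * (M zero (inject₁ j) * det (minor M (inject₁ j))))
  ≡⟨ cong (λ n → - (sgn n * (M zero (inject₁ j) * det (minor M (inject₁ j))))) (sym (toℕ-inject₁ j)) ⟩
    - expansionTerm M (inject₁ j)
  ∎
  where open ≡-Reasoning

-- At every other position m
-- the minor of the swapped matrix is a swapped minor (recursion); the terms are then
-- matched up by reindexing the sum along the exchange.
det-swap : ∀ {k} (M : Mat (suc (suc k))) (j : Fin (suc k)) → det (swapCols M j) ≡ - det M

swap-term-other : ∀ {k} (M : Mat (suc (suc k))) (j : Fin (suc k)) m → m ≢ inject₁ j → m ≢ suc j →
  expansionTerm (swapCols M j) m ≡ - expansionTerm M m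
swap-term-other M j m m≢l m≢r = trans
  (cong₂ (λ c d → sgnᶠ m * (M zero c * d)) (swap-other j m m≢l m≢r) (minorSwapped _ M j m m≢l m≢r))
  (pushNeg (sgnᶠ m) (M zero m) (det (minor M m)))
  where
  pushNeg : ∀ s a d → s * (a * - d) ≡ - (s * (a * d))
  pushNeg = solve-∀
  minorSwapped : ∀ k (M : Mat (suc (suc k))) (j : Fin (suc k)) m → m ≢ inject₁ j → m ≢ suc j →
    det (minor (swapCols M j) m) ≡ - det (minor M m)
  minorSwapped zero M zero zero       m≢l m≢r = ⊥-elim (m≢l refl)
  minorSwapped zero M zero (suc zero) m≢l m≢r = ⊥-elim (m≢r refl)
  minorSwapped (suc k) M j m m≢l m≢r with swap-punchIn-other m j m≢l m≢r
  ... | j′ , commute = trans (det-cong λ r q → cong (M (suc r)) (commute q)) (det-swap (minor M m) j′)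

det-swap {k} M j = begin
    det (swapCols M j)
  ≡⟨ sum-cong term ⟩
    sumFin (λ m → - expansionTerm M (swapAdj j m))
  ≡⟨ sum-neg (expansionTerm M ∘ swapAdj j) ⟩
    - sumFin (expansionTerm M ∘ swapAdj j)
  ≡⟨ cong -_ (sum-swap j (expansionTerm M)) ⟩
    - det M
  ∎
  where
  open ≡-Reasoning
  term : ∀ m → expansionTerm (swapCols M j) m ≡ - expansionTerm M (swapAdj j m)
  term m with m ≟ᶠ inject₁ j | m ≟ᶠ suc j
  ... | yes refl | _        = trans (swap-term-left M j) (cong (-_ ∘ expansionTerm M) (sym (swap-left j)))
  ... | no _     | yes refl = trans (swap-term-right M j) (cong (-_ ∘ expansionTerm M) (sym (swap-right j)))
  ... | no m≢l   | no m≢r   = trans (swap-term-other M j m m≢l m≢r) (cong (-_ ∘ expansionTerm M) (sym (swap-other j m m≢l m≢r)))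

-- A matrix with two equal adjacent columns is fixed by their exchange, hence has determinant 0.
det-adjacent-equal : ∀ {k} (M : Mat (suc (suc k))) (j : Fin (suc k)) →
  (∀ i → M i (inject₁ j) ≡ M i (suc j)) → det M ≡ 0ℤ
det-adjacent-equal M j equal = self-neg (det M) (trans (sym (det-cong unchanged)) (det-swap M j))
  where
  unchanged : ∀ i q → M i (swapAdj j q) ≡ M i q
  unchanged i q with q ≟ᶠ inject₁ j | q ≟ᶠ suc j
  ... | yes refl | _        = trans (cong (M i) (swap-left j)) (sym (equal i))
  ... | no _     | yes refl = trans (cong (M i) (swap-right j)) (equal i)
  ... | no q≢l   | no q≢r   = cong (M i) (swap-other j q q≢l q≢r)

rot : ∀ {k} → Fin (suc k) → Fin (suc k) → Fin (suc k)
rot j zero    = j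
rot j (suc q) = punchIn j q

rot-step : ∀ {k} (j : Fin (suc k)) q → rot (suc j) q ≡ swapAdj j (rot (inject₁ j) q)
rot-step j zero    = sym (swap-left j)
rot-step j (suc q) = sym (swap-punchIn-left j q)

det-rotate-cols : ∀ {k} (M : Mat (suc k)) (j : Fin (suc k)) →
  det (λ i q → M i (rot j q)) ≡ sgnᶠ j * det M
det-rotate-cols M j = byValue (toℕ j) M j refl
  where
  byValue : ∀ n {k} (M : Mat (suc k)) (j : Fin (suc k)) → toℕ j ≡ n →
    det (λ i q → M i (rot j q)) ≡ sgnᶠ j * det M
  byValue n M zero _ = trans (det-cong fixed) (sym (ℤₚ.*-identityˡ (det M)))
    where
    fixed : ∀ i q → M i (rot zero q) ≡ M i q
    fixed i zero    = refl
    fixed i (suc q) = refl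
  byValue (suc n) {suc k} M (suc j) value = begin
      det (λ i q → M i (rot (suc j) q))
    ≡⟨ det-cong (λ i q → cong (M i) (rot-step j q)) ⟩
      det (λ i q → M i (swapAdj j (rot (inject₁ j) q)))
    ≡⟨ byValue n (λ i q → M i (swapAdj j q)) (inject₁ j) (trans (toℕ-inject₁ j) (ℕₚ.suc-injective value)) ⟩
      sgnᶠ (inject₁ j) * det (λ i q → M i (swapAdj j q))
    ≡⟨ cong₂ _*_ (cong sgn (toℕ-inject₁ j)) (det-swap M j) ⟩
      sgnᶠ j * - det M
    ≡⟨ ℤₚ.neg-distribʳ-* (sgnᶠ j) (det M) ⟨
      - (sgnᶠ j * det M)
    ≡⟨ ℤₚ.neg-distribˡ-* (sgnᶠ j) (det M) ⟩
      sgnᶠ (suc j) * det M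
    ∎
    where open ≡-Reasoning

det-rotate-rows : ∀ {k} (M : Mat (suc k)) (j : Fin (suc k)) →
  det (λ i q → M (rot j i) q) ≡ sgnᶠ j * det M
det-rotate-rows M j =
  trans (det-transpose (λ i q → M (rot j q) i))
        (trans (det-rotate-cols (M ᵀ) j) (cong (sgnᶠ j *_) (det-transpose M)))

-- Columns 0 and suc j equal: after moving column suc j to the front they are adjacent.
det-equal-first-col : ∀ {k} (M : Mat (suc (suc k))) (j : Fin (suc k)) →
  (∀ i → M i zero ≡ M i (suc j)) → det M ≡ 0ℤ
det-equal-first-col M j equal = begin
  det M                                        ≡⟨ sign-cancel (sgn-isSign (toℕ (suc j))) (det M) ⟨
  sgnᶠ (suc j) * (sgnᶠ (suc j) * det M)        ≡⟨ cong (sgnᶠ (suc j) *_) (det-rotate-cols M (suc j)) ⟨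
  sgnᶠ (suc j) * det (λ i q → M i (rot (suc j) q)) ≡⟨ cong (sgnᶠ (suc j) *_) (det-adjacent-equal (λ i q → M i (rot (suc j) q)) zero (sym ∘ equal)) ⟩
  sgnᶠ (suc j) * 0ℤ                            ≡⟨ ℤₚ.*-zeroʳ (sgnᶠ (suc j)) ⟩
  0ℤ                                           ∎
  where open ≡-Reasoning

-- Adding a multiple of column 0 to another column does not change the determinant:
-- by linearity the change is α times the determinant of a matrix whose column suc j
-- repeats column 0.
det-add-first-col : ∀ {k} (M M′ : Mat (suc (suc k))) (j : Fin (suc k)) (α : ℤ) →
  (∀ i → M′ i (suc j) ≡ M i (suc j) + α * M i zero) →
  (∀ i q → q ≢ suc j → M′ i q ≡ M i q) →
  det M′ ≡ det M
det-add-first-col {k} M M′ j α onCol offCol = begin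
  det M′                     ≡⟨ det-linear-col M′ M Q (suc j) 1ℤ α onCol′ offCol offQ ⟩
  1ℤ * det M + α * det Q     ≡⟨ cong (λ d → 1ℤ * det M + α * d) (det-equal-first-col Q j repeated) ⟩
  1ℤ * det M + α * 0ℤ        ≡⟨ unit-plus-zero (det M) α ⟩
  det M                      ∎
  where
  open ≡-Reasoning
  Q : Mat (suc (suc k))
  Q i = updateAt (M i) (suc j) (const (M i zero))
  unit-plus-zero : ∀ d a → 1ℤ * d + a * 0ℤ ≡ d
  unit-plus-zero = solve-∀
  onCol′ : ∀ i → M′ i (suc j) ≡ 1ℤ * M i (suc j) + α * Q i (suc j)
  onCol′ i = trans (onCol i) (cong₂ (λ a b → a + α * b) (sym (ℤₚ.*-identityˡ (M i (suc j)))) (sym (updateAt-updates (suc j) (M i))))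
  offQ : ∀ i q → q ≢ suc j → M′ i q ≡ Q i q
  offQ i q q≢ = trans (offCol i q q≢) (sym (updateAt-minimal q (suc j) (M i) q≢))
  repeated : ∀ i → Q i zero ≡ Q i (suc j)
  repeated i = trans (updateAt-minimal zero (suc j) {const (M i zero)} (M i) (λ ())) (sym (updateAt-updates (suc j) (M i)))

addFirstCol : ∀ {k} → Mat (suc k) → (Fin k → ℤ) → Mat (suc k)
addFirstCol M β i zero    = M i zero
addFirstCol M β i (suc q) = M i (suc q) + β q * M i zero

-- The operations are performed one column at a time, from the last nonzero coefficient
-- downwards: by induction on a bound t for the support of β.
det-addFirstCol-below : ∀ t {k} (M : Mat (suc k)) (β : Fin k → ℤ) →
  (∀ q → t ≤ toℕ q → β q ≡ 0ℤ) → det (addFirstCol M β) ≡ det M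
det-addFirstCol-below zero M β vanish = det-cong unchanged
  where
  unchanged : ∀ i q → addFirstCol M β i q ≡ M i q
  unchanged i zero    = refl
  unchanged i (suc q) = trans (cong (λ b → M i (suc q) + b * M i zero) (vanish q z≤n)) (add-zero-times (M i (suc q)) (M i zero))
    where
    add-zero-times : ∀ a m → a + 0ℤ * m ≡ a
    add-zero-times = solve-∀
det-addFirstCol-below (suc t) {k} M β vanish with t ℕₚ.<? k
... | no t≮k = det-addFirstCol-below t M β (λ q t≤q → ⊥-elim (t≮k (ℕₚ.≤-<-trans t≤q (toℕ<n q))))
det-addFirstCol-below (suc t) {suc k} M β vanish | yes t<k = begin
    det (addFirstCol M β)   ≡⟨ det-add-first-col (addFirstCol M β′) (addFirstCol M β) col (β col) onCol offCol ⟩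
    det (addFirstCol M β′)  ≡⟨ det-addFirstCol-below t M β′ vanish′ ⟩
    det M                   ∎
  where
  open ≡-Reasoning
  col : Fin (suc k)
  col = fromℕ< t<k
  β′ : Fin (suc k) → ℤ
  β′ = updateAt β col (const 0ℤ)
  β′-col : β′ col ≡ 0ℤ
  β′-col = updateAt-updates col β
  β′-other : ∀ q → q ≢ col → β′ q ≡ β q
  β′-other q q≢col = updateAt-minimal q col β q≢col
  add-zero-times : ∀ a b m → a + b * m ≡ (a + 0ℤ * m) + b * m
  add-zero-times = solve-∀
  onCol : ∀ i → addFirstCol M β i (suc col) ≡ addFirstCol M β′ i (suc col) + β col * M i zero
  onCol i = trans (add-zero-times (M i (suc col)) (β col) (M i zero))
                  (cong (λ b → (M i (suc col) + b * M i zero) + β col * M i zero) (sym β′-col))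
  offCol : ∀ i q → q ≢ suc col → addFirstCol M β i q ≡ addFirstCol M β′ i q
  offCol i zero    _   = refl
  offCol i (suc q) q≢ = cong (λ b → M i (suc q) + b * M i zero) (sym (β′-other q (q≢ ∘ cong suc)))
  vanish′ : ∀ q → t ≤ toℕ q → β′ q ≡ 0ℤ
  vanish′ q t≤q with q ≟ᶠ col
  ... | yes refl = β′-col
  ... | no q≢col = trans (β′-other q q≢col) (vanish q (ℕₚ.≤∧≢⇒< t≤q t≢q))
    where
    t≢q : t ≢ toℕ q
    t≢q t≡q = q≢col (toℕ-injective (trans (sym t≡q) (sym (toℕ-fromℕ< t<k))))

det-addFirstCol : ∀ {k} (M : Mat (suc k)) (β : Fin k → ℤ) → det (addFirstCol M β) ≡ det M
det-addFirstCol {k} M β = det-addFirstCol-below k M β (λ q k≤q → ⊥-elim (ℕₚ.<⇒≱ (toℕ<n q) k≤q))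

det-first-row-single : ∀ {k} (M : Mat (suc k)) → (∀ q → M zero (suc q) ≡ 0ℤ) →
  det M ≡ M zero zero * det (minor M zero)
det-first-row-single {k} M zeroTail = begin
    det M
  ≡⟨ cong (1ℤ * (M zero zero * det (minor M zero)) +_) (sum-zero {k} vanishing) ⟩
    1ℤ * (M zero zero * det (minor M zero)) + 0ℤ
  ≡⟨ one-plus-zero (M zero zero * det (minor M zero)) ⟩
    M zero zero * det (minor M zero)
  ∎
  where
  open ≡-Reasoning
  one-plus-zero : ∀ x → 1ℤ * x + 0ℤ ≡ x
  one-plus-zero = solve-∀
  vanishing : ∀ q → expansionTerm M (suc q) ≡ 0ℤ
  vanishing q = trans (cong (λ a → sgnᶠ (suc q) * (a * det (minor M (suc q)))) (zeroTail q))
                      (zero-entry (sgnᶠ (suc q)) (det (minor M (suc q))))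

-- Expansion along a row i that vanishes outside column 0: move row i to the top.
det-row-single : ∀ {k} (M : Mat (suc k)) (i : Fin (suc k)) → (∀ q → M i (suc q) ≡ 0ℤ) →
  det M ≡ sgnᶠ i * (M i zero * det (λ r q → M (punchIn i r) (suc q)))
det-row-single M i zeroTail = begin
  det M                                          ≡⟨ sign-cancel (sgn-isSign (toℕ i)) (det M) ⟨
  sgnᶠ i * (sgnᶠ i * det M)                      ≡⟨ cong (sgnᶠ i *_) (det-rotate-rows M i) ⟨
  sgnᶠ i * det (λ r q → M (rot i r) q)           ≡⟨ cong (sgnᶠ i *_) (det-first-row-single (λ r q → M (rot i r) q) zeroTail) ⟩
  sgnᶠ i * (M i zero * det (λ r q → M (punchIn i r) (suc q))) ∎
  where open ≡-Reasoning

argmin : ∀ {k} (g : Fin (suc k) → ℕ) → Σ (Fin (suc k)) λ i → ∀ j → g i ≤ g j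
argmin {zero} g = zero , λ { zero → ℕₚ.≤-refl }
argmin {suc k} g with argmin (g ∘ suc)
... | i , min with g zero ℕₚ.≤? g (suc i)
...   | yes g0≤ = zero  , λ { zero → ℕₚ.≤-refl ; (suc j) → ℕₚ.≤-trans g0≤ (min j) }
...   | no  g0≰ = suc i , λ { zero → ℕₚ.<⇒≤ (ℕₚ.≰⇒> g0≰) ; (suc j) → min j }

ind : Bool → ℤ
ind true  = 1ℤ
ind false = 0ℤ

-- Rows are sets e ⊆ V (membership mem) carrying a rank, such that a set is never split
-- by a set of equal or larger rank: if rank e ≤ rank f and u, v ∈ e then u ∈ f ⇔ v ∈ f
-- (laminar families ranked by cardinality are an example).
module DifferenceMatrix {E V : Set} (mem : E → V → Bool) (rank : E → ℕ)
  (unsplit : ∀ e f → rank e ≤ rank f → ∀ u v → mem e u ≡ true → mem e v ≡ true → mem f u ≡ mem f v)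
  where

  diff : E → V × V → ℤ
  diff e (s , t) = ind (mem e t) - ind (mem e s)

  Separates : E → V × V → Set
  Separates e (s , t) = mem e s ≢ mem e t

  separated-sign : ∀ e p → Separates e p → IsSign (diff e p)
  separated-sign e (s , t) sep with mem e s | mem e t
  ... | false | true  = inj₁ refl
  ... | true  | false = inj₂ refl
  ... | false | false = ⊥-elim (sep refl)
  ... | true  | true  = ⊥-elim (sep refl)

  unseparated-zero : ∀ e s t → mem e s ≡ mem e t → diff e (s , t) ≡ 0ℤ
  unseparated-zero e s t same rewrite same = ℤₚ.+-inverseʳ (ind (mem e t))

  -- Clearing a column q against a pivot column p separated by e: the coefficient of p
  -- to add to q, and the pair describing the resulting column.  If e separates q like p
  -- (resp. oppositely), p is subtracted (resp. added), and the two endpoints lying in e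
  -- cancel by telescoping.
  clearCoef : E → V × V → V × V → ℤ
  clearCoef e (s , t) (s′ , t′) with mem e s | mem e t | mem e s′ | mem e t′
  ... | false | true  | false | true  = -1ℤ
  ... | false | true  | true  | false = 1ℤ
  ... | true  | false | false | true  = 1ℤ
  ... | true  | false | true  | false = -1ℤ
  ... | _     | _     | _     | _     = 0ℤ

  cleared : E → V × V → V × V → V × V
  cleared e (s , t) (s′ , t′) with mem e s | mem e t | mem e s′ | mem e t′
  ... | false | true  | false | true  = s′ , s
  ... | false | true  | true  | false = s , t′
  ... | true  | false | false | true  = s′ , t
  ... | true  | false | true  | false = t , t′
  ... | _     | _     | _     | _     = s′ , t′

  plus-zero : ∀ x y → x + 0ℤ * y ≡ x
  plus-zero = solve-∀
  telescope₁ : ∀ a b c → (a - b) + -1ℤ * (a - c) ≡ c - b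
  telescope₁ = solve-∀
  telescope₂ : ∀ a b c → (a - b) + 1ℤ * (b - c) ≡ a - c
  telescope₂ = solve-∀
  telescope₃ : ∀ a b c → (a - b) + 1ℤ * (c - a) ≡ c - b
  telescope₃ = solve-∀
  telescope₄ : ∀ a b c → (a - b) + -1ℤ * (c - b) ≡ a - c
  telescope₄ = solve-∀

  -- In every row f of rank at least rank e, the column operation produces the cleared pair;
  -- here the endpoints lying in e are not split by f.
  clear-correct : ∀ e f → rank e ≤ rank f → ∀ p q → Separates e p →
    diff f q + clearCoef e p q * diff f p ≡ diff f (cleared e p q)
  clear-correct e f e≤f (s , t) (s′ , t′) sep
    with mem e s in es | mem e t in et | mem e s′ in es′ | mem e t′ in et′
  ... | false | false | _     | _     = ⊥-elim (sep refl)
  ... | true  | true  | _     | _     = ⊥-elim (sep refl)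
  ... | false | true  | false | false = plus-zero (diff f (s′ , t′)) (diff f (s , t))
  ... | false | true  | true  | true  = plus-zero (diff f (s′ , t′)) (diff f (s , t))
  ... | true  | false | false | false = plus-zero (diff f (s′ , t′)) (diff f (s , t))
  ... | true  | false | true  | true  = plus-zero (diff f (s′ , t′)) (diff f (s , t))
  ... | false | true  | false | true  rewrite unsplit e f e≤f t t′ et et′ =
        telescope₁ (ind (mem f t′)) (ind (mem f s′)) (ind (mem f s))
  ... | false | true  | true  | false rewrite unsplit e f e≤f s′ t es′ et =
        telescope₂ (ind (mem f t′)) (ind (mem f t)) (ind (mem f s))
  ... | true  | false | false | true  rewrite unsplit e f e≤f t′ s et′ es =
        telescope₃ (ind (mem f s)) (ind (mem f s′)) (ind (mem f t))
  ... | true  | false | true  | false rewrite unsplit e f e≤f s′ s es′ es =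
        telescope₄ (ind (mem f t′)) (ind (mem f s)) (ind (mem f t))

  -- Row e itself is cleared: both endpoints of the cleared pair lie outside e
  -- (or, if q was not separated, on the same side of e).
  clear-row : ∀ e p q → Separates e p → diff e (cleared e p q) ≡ 0ℤ
  clear-row e (s , t) (s′ , t′) sep
    with mem e s in es | mem e t in et | mem e s′ in es′ | mem e t′ in et′
  ... | false | false | _     | _     = ⊥-elim (sep refl)
  ... | true  | true  | _     | _     = ⊥-elim (sep refl)
  ... | false | true  | false | false = unseparated-zero e s′ t′ (trans es′ (sym et′))
  ... | false | true  | true  | true  = unseparated-zero e s′ t′ (trans es′ (sym et′))
  ... | true  | false | false | false = unseparated-zero e s′ t′ (trans es′ (sym et′))
  ... | true  | false | true  | true  = unseparated-zero e s′ t′ (trans es′ (sym et′))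
  ... | false | true  | false | true  = unseparated-zero e s′ s (trans es′ (sym es))
  ... | false | true  | true  | false = unseparated-zero e s t′ (trans es (sym et′))
  ... | true  | false | false | true  = unseparated-zero e s′ t (trans es′ (sym et))
  ... | true  | false | true  | false = unseparated-zero e t t′ (trans et (sym et′))

  diffMat : ∀ {k} → (Fin k → E) → (Fin k → V × V) → Mat k
  diffMat rows cols i j = diff (rows i) (cols j)

  sameSide? : ∀ e (p : V × V) → Dec (mem e (proj₁ p) ≡ mem e (proj₂ p))
  sameSide? e (s , t) = mem e s Boolₚ.≟ mem e t

  separating-column : ∀ e {k} (cols : Fin k → V × V) →
    (∀ j → diff e (cols j) ≡ 0ℤ) ⊎ ∃ λ j → Separates e (cols j)
  separating-column e {k} cols with all? (sameSide? e ∘ cols)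
  ... | yes same  = inj₁ λ j → unseparated-zero e (proj₁ (cols j)) (proj₂ (cols j)) (same j)
  ... | no notAll = inj₂ (¬∀⟶∃¬ k _ (sameSide? e ∘ cols) notAll)

  clearedCols : E → ∀ {k} → (Fin (suc k) → V × V) → Fin (suc k) → Fin (suc k) → V × V
  clearedCols e cols j₀ zero    = cols j₀
  clearedCols e cols j₀ (suc q) = cleared e (cols j₀) (cols (punchIn j₀ q))

  pivot-step : ∀ {k} (rows : Fin (suc k) → E) (cols : Fin (suc k) → V × V) (i₀ j₀ : Fin (suc k)) →
    (∀ i → rank (rows i₀) ≤ rank (rows i)) → Separates (rows i₀) (cols j₀) →
    det (diffMat rows cols) ≡
      sgnᶠ j₀ * (sgnᶠ i₀ * (diff (rows i₀) (cols j₀) *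
        det (diffMat (rows ∘ punchIn i₀) (clearedCols (rows i₀) cols j₀ ∘ suc))))
  pivot-step {k} rows cols i₀ j₀ minimal sep = begin
      det (diffMat rows cols)
    ≡⟨ sign-cancel (sgn-isSign (toℕ j₀)) (det (diffMat rows cols)) ⟨
      sgnᶠ j₀ * (sgnᶠ j₀ * det (diffMat rows cols))
    ≡⟨ cong (sgnᶠ j₀ *_) (det-rotate-cols (diffMat rows cols) j₀) ⟨
      sgnᶠ j₀ * det (diffMat rows (cols ∘ rot j₀))
    ≡⟨ cong (sgnᶠ j₀ *_) (det-addFirstCol (diffMat rows (cols ∘ rot j₀)) β) ⟨
      sgnᶠ j₀ * det (addFirstCol (diffMat rows (cols ∘ rot j₀)) β)
    ≡⟨ cong (sgnᶠ j₀ *_) (det-cong clearing) ⟩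
      sgnᶠ j₀ * det (diffMat rows (clearedCols e cols j₀))
    ≡⟨ cong (sgnᶠ j₀ *_) (det-row-single (diffMat rows (clearedCols e cols j₀)) i₀
                            (λ q → clear-row e (cols j₀) (cols (punchIn j₀ q)) sep)) ⟩
      sgnᶠ j₀ * (sgnᶠ i₀ * (diff e (cols j₀) * det (diffMat (rows ∘ punchIn i₀) (clearedCols e cols j₀ ∘ suc))))
    ∎
    where
    open ≡-Reasoning
    e : E
    e = rows i₀
    β : Fin k → ℤ
    β q = clearCoef e (cols j₀) (cols (punchIn j₀ q))
    clearing : ∀ i q → addFirstCol (diffMat rows (cols ∘ rot j₀)) β i q ≡ diffMat rows (clearedCols e cols j₀) i q
    clearing i zero    = refl
    clearing i (suc q) = clear-correct e (rows i) (minimal i) (cols j₀) (cols (punchIn j₀ q)) sep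

  diffMat-0±1 : ∀ k (rows : Fin k → E) (cols : Fin k → V × V) → Is0±1 (det (diffMat rows cols))
  diffMat-0±1 zero    rows cols = inj₂ (inj₁ refl)
  diffMat-0±1 (suc k) rows cols with argmin (rank ∘ rows)
  ... | i₀ , minimal with separating-column (rows i₀) cols
  ...   | inj₁ rowZero = inj₁ (det-zero-row (diffMat rows cols) i₀ rowZero)
  ...   | inj₂ (j₀ , sep) = subst Is0±1 (sym (pivot-step rows cols i₀ j₀ minimal sep))
          (sign-*-0±1 (sgn-isSign (toℕ j₀)) (sign-*-0±1 (sgn-isSign (toℕ i₀))
            (sign-*-0±1 (separated-sign (rows i₀) (cols j₀) sep)
              (diffMat-0±1 k (rows ∘ punchIn i₀) (clearedCols (rows i₀) cols j₀ ∘ suc)))))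

prodFin : ∀ {k} → (Fin k → ℤ) → ℤ
prodFin {zero}  σ = 1ℤ
prodFin {suc k} σ = σ zero * prodFin (σ ∘ suc)

prodFin-sign : ∀ {k} (σ : Fin k → ℤ) → (∀ i → IsSign (σ i)) → IsSign (prodFin σ)
prodFin-sign {zero}  σ signs = inj₁ refl
prodFin-sign {suc k} σ signs = sign-* (signs zero) (prodFin-sign (σ ∘ suc) (signs ∘ suc))

det-scale-rows : ∀ {k} (σ : Fin k → ℤ) (M : Mat k) → det (λ i j → σ i * M i j) ≡ prodFin σ * det M
det-scale-rows {zero}  σ M = refl
det-scale-rows {suc k} σ M = trans (sum-cong term) (sum-scale (prodFin σ) (expansionTerm M))
  where
  regroup : ∀ s a m p d → s * ((a * m) * (p * d)) ≡ (a * p) * (s * (m * d))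
  regroup = solve-∀
  term : ∀ j → sgnᶠ j * ((σ zero * M zero j) * det (λ r q → σ (suc r) * minor M j r q))
             ≡ prodFin σ * expansionTerm M j
  term j = trans (cong (λ d → sgnᶠ j * ((σ zero * M zero j) * d)) (det-scale-rows (σ ∘ suc) (minor M j)))
                 (regroup (sgnᶠ j) (σ zero) (M zero j) (prodFin (σ ∘ suc)) (det (minor M j)))

-- Points: left i and right i (i ∈ [n]) and two extra points hub, hub′.  Columns are the
-- pairs x i = (left i , hub), y i = (hub′ , right i), z i = (left i , right i); rows are the
-- sets a₁ = {left _}, a₂ = {right _}, a₃ = {right _} ∪ {hub′}, b i = {left i}, c i = {right i},
-- with the rows a₁ and b i negated.  Ranking singletons 0, a₁ and a₂ 1, and a₃ 2, no set is
-- split by a set of equal or larger rank.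
data Node (n : ℕ) : Set where
  left right : Fin n → Node n
  hub hub′   : Node n

member : ∀ {n} → Row n → Node n → Bool
member a₁    (left _)  = true
member a₂    (right _) = true
member a₃    (right _) = true
member a₃    hub′      = true
member (b i) (left j)  = ⌊ i ≟ᶠ j ⌋
member (c i) (right j) = ⌊ i ≟ᶠ j ⌋
member _     _         = false

rank : ∀ {n} → Row n → ℕ
rank a₁    = 1
rank a₂    = 1
rank a₃    = 2
rank (b _) = 0
rank (c _) = 0

rowSign : ∀ {n} → Row n → ℤ
rowSign a₁    = -1ℤ
rowSign a₂    = 1ℤ
rowSign a₃    = 1ℤ
rowSign (b _) = -1ℤ
rowSign (c _) = 1ℤ

rowSign-sign : ∀ {n} (e : Row n) → IsSign (rowSign e)
rowSign-sign a₁    = inj₂ refl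
rowSign-sign a₂    = inj₁ refl
rowSign-sign a₃    = inj₁ refl
rowSign-sign (b _) = inj₂ refl
rowSign-sign (c _) = inj₁ refl

arc : ∀ {n} → Col n → Node n × Node n
arc (x i) = left i , hub
arc (y i) = hub′ , right i
arc (z i) = left i , right i

in-b : ∀ {n} (i : Fin n) u → member (b i) u ≡ true → u ≡ left i
in-b i (left j) i∈ with i ≟ᶠ j
in-b i (left j) i∈ | yes refl = refl
in-b i (left j) () | no _
in-b i (right _) ()
in-b i hub ()
in-b i hub′ ()

in-c : ∀ {n} (i : Fin n) u → member (c i) u ≡ true → u ≡ right i
in-c i (right j) i∈ with i ≟ᶠ j
in-c i (right j) i∈ | yes refl = refl
in-c i (right j) () | no _
in-c i (left _) ()
in-c i hub ()
in-c i hub′ ()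

unsplit : ∀ {n} (e f : Row n) → rank e ≤ rank f →
  ∀ u v → member e u ≡ true → member e v ≡ true → member f u ≡ member f v
unsplit (b i) f _ u v u∈ v∈ = cong (member f) (trans (in-b i u u∈) (sym (in-b i v v∈)))
unsplit (c i) f _ u v u∈ v∈ = cong (member f) (trans (in-c i u u∈) (sym (in-c i v v∈)))
unsplit a₃ a₃ _ u v u∈ v∈ = trans u∈ (sym v∈)
unsplit a₃ a₁ (s≤s ()) _ _ _ _
unsplit a₃ a₂ (s≤s ()) _ _ _ _
unsplit a₁ a₁ _ (left _) (left _) _ _ = refl
unsplit a₁ a₂ _ (left _) (left _) _ _ = refl
unsplit a₁ a₃ _ (left _) (left _) _ _ = refl
unsplit a₂ a₁ _ (right _) (right _) _ _ = refl
unsplit a₂ a₂ _ (right _) (right _) _ _ = refl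
unsplit a₂ a₃ _ (right _) (right _) _ _ = refl

open module Difference {n : ℕ} = DifferenceMatrix (member {n}) (rank {n}) unsplit
  using (diff; diffMat; diffMat-0±1)

A-factor : ∀ {n} (e : Row n) (col : Col n) → A n e col ≡ rowSign e * diff e (arc col)
A-factor a₁ (x _) = refl
A-factor a₁ (y _) = refl
A-factor a₁ (z _) = refl
A-factor a₂ (x _) = refl
A-factor a₂ (y _) = refl
A-factor a₂ (z _) = refl
A-factor a₃ (x _) = refl
A-factor a₃ (y _) = refl
A-factor a₃ (z _) = refl
A-factor (b i) (y j) = refl
A-factor (c i) (x j) = refl
A-factor (b i) (x j) with i ≟ᶠ j
... | yes _ = refl
... | no  _ = refl
A-factor (b i) (z j) with i ≟ᶠ j
... | yes _ = refl
... | no  _ = refl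
A-factor (c i) (y j) with i ≟ᶠ j
... | yes _ = refl
... | no  _ = refl
A-factor (c i) (z j) with i ≟ᶠ j
... | yes _ = refl
... | no  _ = refl

theorem3 : (n : ℕ) → 1 ≤ n → TotallyUnimodular (A n)
theorem3 n _ k rows cols _ _ = subst Is0±1 (sym factorisation)
  (sign-*-0±1 (prodFin-sign (rowSign ∘ rows) (rowSign-sign ∘ rows)) (diffMat-0±1 k rows (arc ∘ cols)))
  where
  factorisation : det (λ i j → A n (rows i) (cols j)) ≡ prodFin (rowSign ∘ rows) * det (diffMat rows (arc ∘ cols))
  factorisation = trans (det-cong (λ i j → A-factor (rows i) (cols j)))
                        (det-scale-rows (rowSign ∘ rows) (diffMat rows (arc ∘ cols)))
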